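{- Let $n\ge 16$ and let $k$ be an integer with $k\ge\lg n$. Let $X=\{a_1,a_2,\dots\}$ be a finite multiset of integers from $\{0,1,\dots,n-1\}$ such that for every $l\le k$ and any two disjoint index sets $\{i_1,\dots,i_l\}$ and $\{j_1,\dots,j_l\}$ (each consisting of $l$ distinct indices) we have $a_{i_1}+\dots+a_{i_l}\ne a_{j_1}+\dots+a_{j_l}$. Then $|X|<2k$.
   Context: $\lg$ denotes the logarithm in base $2$. -}

module Defs where

open import Data.Nat using (ℕ; zero; suc; _+_)
open import Data.Fin using (Fin; zero; suc)
open import Data.Vec using (_∷_; [])
open import Data.Bool using (true; false)
open import Data.Fin.Subset using (Subset)

subsetSum : ∀ {m} → (Fin m → ℕ) → Subset m → ℕ
subsetSum {zero}  a []            = 0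
subsetSum {suc m} a (true  ∷ I)   = a zero + subsetSum (λ i → a (suc i)) I
subsetSum {suc m} a (false ∷ I)   = subsetSum (λ i → a (suc i)) I

-- If m ≥ 2k, the C(m,k) subsets of size k all have sums in {0, …, k n}, and
-- C(m,k) ≥ C(2k,k) ≥ k 2ᵏ + 2 > k n + 1 once k ≥ 4 (which n ≥ 16 forces); the
-- middle bound holds at k = 4 and propagates because the absorption identity gives
-- C(2k+2,k+1) = (4k+2)/(k+1) · C(2k,k) ≥ 3 C(2k,k).  By
-- pigeonhole two different k-subsets I ≠ J have the same sum; removing I ∩ J
-- from both leaves disjoint, nonempty sets of equal size ≤ k with equal sums.
module Submission where

open import Defs
open import Data.Nat using (ℕ; zero; suc; _+_; _*_; _^_; _≤_; _<_; z≤n; s≤s)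
open import Data.Nat.Properties
open import Data.Nat.Solver using (module +-*-Solver)
open import Algebra.Properties.CommutativeSemigroup +-commutativeSemigroup using (x∙yz≈y∙xz)
open import Data.Fin using (Fin; zero; suc; splitAt; join; fromℕ<; toℕ)
import Data.Fin as Fin
open import Data.Fin.Properties using (join-splitAt; pigeonhole; toℕ-fromℕ<)
  renaming (<⇒≢ to <⇒≢ᶠ)
open import Data.Fin.Subset using (Subset; ∣_∣; _∩_; _─_; Empty; ⊥; inside; outside)
open import Data.Fin.Subset.Properties using (∣⊥∣≡0; ∩-comm; p─q⊆p; p⊆q⇒∣p∣≤∣q∣)
open import Data.Vec using (_∷_; []; there)
open import Data.Vec.Properties using (∷-injectiveʳ)
open import Data.Sum using (_⊎_; inj₁; inj₂)
open import Data.Product using (_×_; _,_; ∃₂)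
open import Relation.Binary.PropositionalEquality
open import Function using (_∘_)

binomial : ℕ → ℕ → ℕ
binomial _       zero    = 1
binomial zero    (suc k) = 0
binomial (suc n) (suc k) = binomial n k + binomial n (suc k)

binomial[n,1]≡n : ∀ n → binomial n 1 ≡ n
binomial[n,1]≡n zero    = refl
binomial[n,1]≡n (suc n) = cong suc (binomial[n,1]≡n n)

binomial-absorption : ∀ n k → suc k * binomial (suc n) (suc k) ≡ suc n * binomial n k
binomial-absorption zero    zero    = refl
binomial-absorption zero    (suc k) = *-zeroʳ (suc (suc k))
binomial-absorption (suc n) zero    = begin
  1 * binomial (suc (suc n)) 1           ≡⟨ *-identityˡ _ ⟩
  binomial (suc (suc n)) 1               ≡⟨ binomial[n,1]≡n (suc (suc n)) ⟩
  suc (suc n)                            ≡⟨ *-identityʳ (suc (suc n)) ⟨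
  suc (suc n) * 1                        ∎
  where open ≡-Reasoning
binomial-absorption (suc n) (suc k) = begin
  suc (suc k) * (X + Y)                  ≡⟨ *-distribˡ-+ (suc (suc k)) X Y ⟩
  suc (suc k) * X + suc (suc k) * Y      ≡⟨ cong (suc (suc k) * X +_) (binomial-absorption n (suc k)) ⟩
  X + suc k * X + suc n * Q              ≡⟨ cong (λ z → X + z + suc n * Q) (binomial-absorption n k) ⟩
  X + suc n * P + suc n * Q              ≡⟨ +-assoc X (suc n * P) (suc n * Q) ⟩
  X + (suc n * P + suc n * Q)            ≡⟨ cong (X +_) (*-distribˡ-+ (suc n) P Q) ⟨
  suc (suc n) * X                        ∎
  where
  open ≡-Reasoning
  X = binomial (suc n) (suc k)
  Y = binomial (suc n) (suc (suc k))
  P = binomial n k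
  Q = binomial n (suc k)

binomial-monoˡ-≤ : ∀ {m m′} k → m ≤ m′ → binomial m k ≤ binomial m′ k
binomial-monoˡ-≤ zero    _ = ≤-refl
binomial-monoˡ-≤ (suc k) z≤n = z≤n
binomial-monoˡ-≤ (suc k) (s≤s m≤m′) =
  +-mono-≤ (binomial-monoˡ-≤ k m≤m′) (binomial-monoˡ-≤ (suc k) m≤m′)

centralBinomial : ℕ → ℕ
centralBinomial k = binomial (k + k) k

binomial[1+2k,k]≡binomial[1+2k,1+k] :
  ∀ k → binomial (suc (k + k)) k ≡ binomial (suc (k + k)) (suc k)
binomial[1+2k,k]≡binomial[1+2k,1+k] k =
  *-cancelˡ-≡ X Y (suc k) (+-cancelˡ-≡ (suc k * X) _ _ (begin
    suc k * X + suc k * X   ≡⟨ solve 2 (λ k x → (con 1 :+ k) :* x :+ (con 1 :+ k) :* x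
                                           := (con 2 :+ k :+ k) :* x) refl k X ⟩
    suc (suc (k + k)) * X   ≡⟨ binomial-absorption (suc (k + k)) k ⟨
    suc k * (X + Y)         ≡⟨ *-distribˡ-+ (suc k) X Y ⟩
    suc k * X + suc k * Y   ∎))
  where
  open ≡-Reasoning
  open +-*-Solver
  X = binomial (suc (k + k)) k
  Y = binomial (suc (k + k)) (suc k)

centralBinomial-suc :
  ∀ k → suc k * centralBinomial (suc k) ≡ 2 * (suc (k + k) * centralBinomial k)
centralBinomial-suc k = begin
  suc k * binomial (suc k + suc k) (suc k)  ≡⟨ cong (λ z → suc k * binomial (suc z) (suc k)) (+-suc k k) ⟩
  suc k * (X + Y)                           ≡⟨ cong (λ z → suc k * (z + Y)) (binomial[1+2k,k]≡binomial[1+2k,1+k] k) ⟩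
  suc k * (Y + Y)                           ≡⟨ *-distribˡ-+ (suc k) Y Y ⟩
  suc k * Y + suc k * Y                     ≡⟨ cong (λ z → z + z) (binomial-absorption (k + k) k) ⟩
  Z + Z                                     ≡⟨ cong (Z +_) (+-identityʳ Z) ⟨
  2 * Z                                     ∎
  where
  open ≡-Reasoning
  X = binomial (suc (k + k)) k
  Y = binomial (suc (k + k)) (suc k)
  Z = suc (k + k) * centralBinomial k

3*centralBinomial≤centralBinomial-suc :
  ∀ k → 3 * centralBinomial (suc k) ≤ centralBinomial (suc (suc k))
3*centralBinomial≤centralBinomial-suc k = *-cancelˡ-≤ (2 + k) (begin
  (2 + k) * (3 * D)                    ≤⟨ m≤m+n _ (k * D) ⟩
  (2 + k) * (3 * D) + k * D            ≡⟨ solve 2 (λ k d → (con 2 :+ k) :* (con 3 :* d) :+ k :* d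
                                              := con 2 :* ((con 1 :+ ((con 1 :+ k) :+ (con 1 :+ k))) :* d))
                                              refl k D ⟩
  2 * (suc (suc k + suc k) * D)        ≡⟨ centralBinomial-suc (suc k) ⟨
  (2 + k) * centralBinomial (2 + k)    ∎)
  where
  open ≤-Reasoning
  open +-*-Solver
  D = centralBinomial (suc k)

k*2^k+2-growth : ∀ i → (3 + i) * 2 ^ (3 + i) + 2 ≤ 3 * ((2 + i) * 2 ^ (2 + i) + 2)
k*2^k+2-growth i = begin
  (3 + i) * (2 * x) + 2                  ≤⟨ m≤m+n _ (i * x + 4) ⟩
  (3 + i) * (2 * x) + 2 + (i * x + 4)    ≡⟨ solve 2 (λ i x → ((con 3 :+ i) :* (con 2 :* x) :+ con 2) :+ (i :* x :+ con 4)
                                                := con 3 :* ((con 2 :+ i) :* x :+ con 2)) refl i x ⟩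
  3 * ((2 + i) * x + 2)                  ∎
  where
  open ≤-Reasoning
  open +-*-Solver
  x = 2 ^ (2 + i)

centralBinomial-lowerBound : ∀ k → 4 ≤ k → k * 2 ^ k + 2 ≤ centralBinomial k
centralBinomial-lowerBound k 4≤k with m≤n⇒∃[o]m+o≡n 4≤k
... | j , refl = go j
  where
  go : ∀ j → (4 + j) * 2 ^ (4 + j) + 2 ≤ centralBinomial (4 + j)
  go zero    = m≤m+n 66 4  -- C(8,4) = 70
  go (suc j) = begin
    (5 + j) * 2 ^ (5 + j) + 2          ≤⟨ k*2^k+2-growth (2 + j) ⟩
    3 * ((4 + j) * 2 ^ (4 + j) + 2)    ≤⟨ *-monoʳ-≤ 3 (go j) ⟩
    3 * centralBinomial (4 + j)        ≤⟨ 3*centralBinomial≤centralBinomial-suc (3 + j) ⟩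
    centralBinomial (5 + j)            ∎
    where open ≤-Reasoning

mutual
  kSubset : ∀ m k → Fin (binomial m k) → Subset m
  kSubset m       zero    _ = ⊥
  kSubset (suc m) (suc k) i = kSubsetByHead m k (splitAt (binomial m k) i)

  kSubsetByHead : ∀ m k → Fin (binomial m k) ⊎ Fin (binomial m (suc k)) → Subset (suc m)
  kSubsetByHead m k (inj₁ i) = inside  ∷ kSubset m k i
  kSubsetByHead m k (inj₂ i) = outside ∷ kSubset m (suc k) i

mutual
  ∣kSubset∣≡k : ∀ m k i → ∣ kSubset m k i ∣ ≡ k
  ∣kSubset∣≡k m       zero    _ = ∣⊥∣≡0 m
  ∣kSubset∣≡k (suc m) (suc k) i = ∣kSubsetByHead∣≡1+k m k (splitAt (binomial m k) i)

  ∣kSubsetByHead∣≡1+k : ∀ m k u → ∣ kSubsetByHead m k u ∣ ≡ suc k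
  ∣kSubsetByHead∣≡1+k m k (inj₁ i) = cong suc (∣kSubset∣≡k m k i)
  ∣kSubsetByHead∣≡1+k m k (inj₂ i) = ∣kSubset∣≡k m (suc k) i

mutual
  kSubset-injective : ∀ m k {i j} → kSubset m k i ≡ kSubset m k j → i ≡ j
  kSubset-injective m       zero    {zero} {zero} _ = refl
  kSubset-injective (suc m) (suc k) {i}    {j}    eq = begin
    i                                      ≡⟨ join-splitAt (binomial m k) _ i ⟨
    join _ _ (splitAt (binomial m k) i)    ≡⟨ cong (join _ _) (kSubsetByHead-injective m k eq) ⟩
    join _ _ (splitAt (binomial m k) j)    ≡⟨ join-splitAt (binomial m k) _ j ⟩
    j                                      ∎
    where open ≡-Reasoning

  kSubsetByHead-injective : ∀ m k {u v} → kSubsetByHead m k u ≡ kSubsetByHead m k v → u ≡ v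
  kSubsetByHead-injective m k {inj₁ i} {inj₁ j} eq =
    cong inj₁ (kSubset-injective m k (∷-injectiveʳ eq))
  kSubsetByHead-injective m k {inj₂ i} {inj₂ j} eq =
    cong inj₂ (kSubset-injective m (suc k) (∷-injectiveʳ eq))

∣p∣≡∣p∩q∣+∣p─q∣ : ∀ {m} (p q : Subset m) → ∣ p ∣ ≡ ∣ p ∩ q ∣ + ∣ p ─ q ∣
∣p∣≡∣p∩q∣+∣p─q∣ []            []            = refl
∣p∣≡∣p∩q∣+∣p─q∣ (inside  ∷ p) (inside  ∷ q) = cong suc (∣p∣≡∣p∩q∣+∣p─q∣ p q)
∣p∣≡∣p∩q∣+∣p─q∣ (inside  ∷ p) (outside ∷ q) = trans (cong suc (∣p∣≡∣p∩q∣+∣p─q∣ p q)) (sym (+-suc _ _))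
∣p∣≡∣p∩q∣+∣p─q∣ (outside ∷ p) (inside  ∷ q) = ∣p∣≡∣p∩q∣+∣p─q∣ p q
∣p∣≡∣p∩q∣+∣p─q∣ (outside ∷ p) (outside ∷ q) = ∣p∣≡∣p∩q∣+∣p─q∣ p q

subsetSum≡subsetSum[p∩q]+subsetSum[p─q] : ∀ {m} (a : Fin m → ℕ) (p q : Subset m) →
  subsetSum a p ≡ subsetSum a (p ∩ q) + subsetSum a (p ─ q)
subsetSum≡subsetSum[p∩q]+subsetSum[p─q] a []            []            = refl
subsetSum≡subsetSum[p∩q]+subsetSum[p─q] a (inside  ∷ p) (inside  ∷ q) =
  trans (cong (a zero +_) (subsetSum≡subsetSum[p∩q]+subsetSum[p─q] (a ∘ suc) p q))
        (sym (+-assoc (a zero) _ _))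
subsetSum≡subsetSum[p∩q]+subsetSum[p─q] a (inside  ∷ p) (outside ∷ q) =
  trans (cong (a zero +_) (subsetSum≡subsetSum[p∩q]+subsetSum[p─q] (a ∘ suc) p q))
        (x∙yz≈y∙xz (a zero) (subsetSum (a ∘ suc) (p ∩ q)) _)
subsetSum≡subsetSum[p∩q]+subsetSum[p─q] a (outside ∷ p) (inside  ∷ q) =
  subsetSum≡subsetSum[p∩q]+subsetSum[p─q] (a ∘ suc) p q
subsetSum≡subsetSum[p∩q]+subsetSum[p─q] a (outside ∷ p) (outside ∷ q) =
  subsetSum≡subsetSum[p∩q]+subsetSum[p─q] (a ∘ suc) p q

subsetSum≤∣p∣*c : ∀ {m} (a : Fin m → ℕ) {c} → (∀ i → a i ≤ c) →
  (p : Subset m) → subsetSum a p ≤ ∣ p ∣ * c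
subsetSum≤∣p∣*c a a≤c []            = z≤n
subsetSum≤∣p∣*c a a≤c (inside  ∷ p) = +-mono-≤ (a≤c zero) (subsetSum≤∣p∣*c (a ∘ suc) (a≤c ∘ suc) p)
subsetSum≤∣p∣*c a a≤c (outside ∷ p) = subsetSum≤∣p∣*c (a ∘ suc) (a≤c ∘ suc) p

Empty[p─q∩q─p] : ∀ {m} (p q : Subset m) → Empty ((p ─ q) ∩ (q ─ p))
Empty[p─q∩q─p] (inside  ∷ p) (inside  ∷ q) (suc i , there i∈) = Empty[p─q∩q─p] p q (i , i∈)
Empty[p─q∩q─p] (inside  ∷ p) (outside ∷ q) (suc i , there i∈) = Empty[p─q∩q─p] p q (i , i∈)
Empty[p─q∩q─p] (outside ∷ p) (inside  ∷ q) (suc i , there i∈) = Empty[p─q∩q─p] p q (i , i∈)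
Empty[p─q∩q─p] (outside ∷ p) (outside ∷ q) (suc i , there i∈) = Empty[p─q∩q─p] p q (i , i∈)

∣p─q∣≡0⇒∣q─p∣≡0⇒p≡q : ∀ {m} (p q : Subset m) → ∣ p ─ q ∣ ≡ 0 → ∣ q ─ p ∣ ≡ 0 → p ≡ q
∣p─q∣≡0⇒∣q─p∣≡0⇒p≡q []            []            _ _ = refl
∣p─q∣≡0⇒∣q─p∣≡0⇒p≡q (inside  ∷ p) (inside  ∷ q) e e′ =
  cong (inside ∷_) (∣p─q∣≡0⇒∣q─p∣≡0⇒p≡q p q e e′)
∣p─q∣≡0⇒∣q─p∣≡0⇒p≡q (outside ∷ p) (outside ∷ q) e e′ =
  cong (outside ∷_) (∣p─q∣≡0⇒∣q─p∣≡0⇒p≡q p q e e′)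

f[p─q]≡f[q─p] : ∀ {m} (f : Subset m → ℕ) → (∀ p q → f p ≡ f (p ∩ q) + f (p ─ q)) →
  ∀ p q → f p ≡ f q → f (p ─ q) ≡ f (q ─ p)
f[p─q]≡f[q─p] f additive p q fp≡fq = +-cancelˡ-≡ (f (p ∩ q)) _ _ (begin
  f (p ∩ q) + f (p ─ q)    ≡⟨ additive p q ⟨
  f p                      ≡⟨ fp≡fq ⟩
  f q                      ≡⟨ additive q p ⟩
  f (q ∩ p) + f (q ─ p)    ≡⟨ cong (λ r → f r + f (q ─ p)) (∩-comm q p) ⟩
  f (p ∩ q) + f (q ─ p)    ∎)
  where open ≡-Reasoning

p≢q⇒1≤∣p─q∣ : ∀ {m} {p q : Subset m} → p ≢ q → ∣ p ─ q ∣ ≡ ∣ q ─ p ∣ → 1 ≤ ∣ p ─ q ∣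
p≢q⇒1≤∣p─q∣ {p = p} {q} p≢q ∣p─q∣≡∣q─p∣ =
  n≢0⇒n>0 (λ ∣p─q∣≡0 → p≢q (∣p─q∣≡0⇒∣q─p∣≡0⇒p≡q p q ∣p─q∣≡0 (trans (sym ∣p─q∣≡∣q─p∣) ∣p─q∣≡0)))

distinctKSubsetsWithEqualSums : ∀ {m} (a : Fin m → ℕ) {c} k → (∀ i → a i ≤ c) →
  suc (k * c) < binomial m k →
  ∃₂ λ I J → I ≢ J × ∣ I ∣ ≡ k × ∣ J ∣ ≡ k × subsetSum a I ≡ subsetSum a J
distinctKSubsetsWithEqualSums {m} a {c} k a≤c sums<subsets =
  let i , j , i<j , sumᵢ≡sumⱼ = pigeonhole sums<subsets (λ i → fromℕ< (sum< i))
  in  kSubset m k i , kSubset m k j , kSubset-distinct i<j ,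
      ∣kSubset∣≡k m k i , ∣kSubset∣≡k m k j , subsetSum-reflect sumᵢ≡sumⱼ
  where
  sum< : ∀ i → subsetSum a (kSubset m k i) < suc (k * c)
  sum< i = s≤s (subst (λ s → subsetSum a (kSubset m k i) ≤ s * c) (∣kSubset∣≡k m k i)
                      (subsetSum≤∣p∣*c a a≤c (kSubset m k i)))

  subsetSum-reflect : ∀ {i j} → fromℕ< (sum< i) ≡ fromℕ< (sum< j) →
                      subsetSum a (kSubset m k i) ≡ subsetSum a (kSubset m k j)
  subsetSum-reflect {i} {j} eq = begin
    subsetSum a (kSubset m k i)    ≡⟨ toℕ-fromℕ< (sum< i) ⟨
    toℕ (fromℕ< (sum< i))          ≡⟨ cong toℕ eq ⟩
    toℕ (fromℕ< (sum< j))          ≡⟨ toℕ-fromℕ< (sum< j) ⟩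
    subsetSum a (kSubset m k j)    ∎
    where open ≡-Reasoning

  kSubset-distinct : ∀ {i j} → i Fin.< j → kSubset m k i ≢ kSubset m k j
  kSubset-distinct i<j eq = <⇒≢ᶠ i<j (kSubset-injective m k eq)

1+k*n<binomial : ∀ {n k m} → 16 ≤ n → n ≤ 2 ^ k → 2 * k ≤ m → suc (k * n) < binomial m k
1+k*n<binomial {n} {k} {m} 16≤n n≤2^k 2k≤m = begin-strict
  suc (k * n)          <⟨ n<1+n _ ⟩
  2 + k * n            ≡⟨ +-comm 2 (k * n) ⟩
  k * n + 2            ≤⟨ +-monoˡ-≤ 2 (*-monoʳ-≤ k n≤2^k) ⟩
  k * 2 ^ k + 2        ≤⟨ centralBinomial-lowerBound k 4≤k ⟩
  centralBinomial k    ≤⟨ binomial-monoˡ-≤ k (subst (_≤ m) (cong (k +_) (+-identityʳ k)) 2k≤m) ⟩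
  binomial m k         ∎
  where
  open ≤-Reasoning
  4≤k : 4 ≤ k
  4≤k = ≮⇒≥ (λ k<4 → <⇒≱ (^-monoʳ-< 2 (n<1+n 1) k<4) (≤-trans 16≤n n≤2^k))

mainTheorem6 : (n k m : ℕ) → 16 ≤ n → n ≤ 2 ^ k →
    (a : Fin m → ℕ) → (∀ i → a i < n) →
    (∀ (I J : Subset m) → Empty (I ∩ J) → ∣ I ∣ ≡ ∣ J ∣ → 1 ≤ ∣ I ∣ → ∣ I ∣ ≤ k →
    subsetSum a I ≢ subsetSum a J) →
    m < 2 * k
mainTheorem6 n k m 16≤n n≤2^k a a<n sums-distinct = ≰⇒> λ 2k≤m →
  let I , J , I≢J , ∣I∣≡k , ∣J∣≡k , ΣI≡ΣJ =
        distinctKSubsetsWithEqualSums a k (<⇒≤ ∘ a<n) (1+k*n<binomial {k = k} 16≤n n≤2^k 2k≤m)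
      ∣I─J∣≡∣J─I∣ = f[p─q]≡f[q─p] ∣_∣ ∣p∣≡∣p∩q∣+∣p─q∣ I J (trans ∣I∣≡k (sym ∣J∣≡k))
  in  sums-distinct (I ─ J) (J ─ I) (Empty[p─q∩q─p] I J) ∣I─J∣≡∣J─I∣
        (p≢q⇒1≤∣p─q∣ I≢J ∣I─J∣≡∣J─I∣)
        (subst (∣ I ─ J ∣ ≤_) ∣I∣≡k (p⊆q⇒∣p∣≤∣q∣ (p─q⊆p I J)))
        (f[p─q]≡f[q─p] (subsetSum a) (subsetSum≡subsetSum[p∩q]+subsetSum[p─q] a) I J ΣI≡ΣJ)
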